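{- Let $\mathbf t:\mathcal D\to\mathcal T$ be a functor (a refinement system), let $B$ be an object of $\mathcal T$ and let $Q\sqsubset B$. Then there are natural isomorphisms of presheaves $$Q^- \;\cong\; (Q^+)^{\perp}\quad\text{(presheaves on } B^-\text{)}\qquad\text{and}\qquad Q^+\;\cong\;{}^{\perp}(Q^-)\quad\text{(presheaves on } B^+\text{)}.$$
   Context: A refinement system is a functor $\mathbf t:\mathcal D\to\mathcal T$. Write $P\sqsubset A$ ("$P$ refines $A$") if $P\in\mathcal D$ and $\mathbf t(P)=A$. Composition is written diagrammatically: $c;d$ means $c$ followed by $d$. For $c:A\to B$ in $\mathcal T$, $P\sqsubset A$, $Q\sqsubset B$, a derivation $\alpha:P\Rightarrow_c Q$ is a morphism $\alpha:P\to Q$ of $\mathcal D$ with $\mathbf t(\alpha)=c$. Relative slice $B^+$: objects are pairs $(P,c)$ with $P\sqsubset A$ and $c:A\to B$; morphisms $(P_1,c_1)\to(P_2,c_2)$ are derivations $\alpha:P_1\Rightarrow_e P_2$ with $c_1=e;c_2$. The presheaf $Q^+:(B^+)^{op}\to\mathbf{Set}$ sends $(P,c)$ to the set of derivations $P\Rightarrow_c Q$, a morphism $\alpha$ acting by $\beta\mapsto\alpha;\beta$. Relative coslice of $B$: objects are pairs $(d,R)$ with $d:B\to C$ and $R\sqsubset C$; morphisms $(d_1,R_1)\to(d_2,R_2)$ are derivations $\gamma:R_1\Rightarrow_e R_2$ with $d_1;e=d_2$. $B^-$ denotes the opposite of this category. The presheaf $Q^-:(B^-)^{op}\to\mathbf{Set}$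 (i.e. a covariant functor on the coslice) sends $(d,R)$ to the set of derivations $Q\Rightarrow_d R$, a coslice morphism $\gamma$ acting by $\beta\mapsto\beta;\gamma$. Category of judgments $J(\mathbf t)$: objects are triples $(P,c,Q)$ with $P\sqsubset A$, $c:A\to B$, $Q\sqsubset B$; morphisms $(P_1,c_1,Q_1)\to(P_2,c_2,Q_2)$ are pairs of derivations $\beta:P_1\Rightarrow_e P_2$, $\gamma:Q_2\Rightarrow_{e'}Q_1$ with $c_1=e;c_2;e'$. The presheaf of derivations $\mathrm{Der}:J(\mathbf t)^{op}\to\mathbf{Set}$ sends $(P,c,Q)$ to the set of derivations $P\Rightarrow_c Q$, a morphism $(\beta,\gamma)$ acting by $\alpha\mapsto\beta;\alpha;\gamma$. The $B$-bracket $\langle-,-\rangle_B:B^+\times B^-\to J(\mathbf t)$ sends $((P,c),(d,R))$ to $(P,c;d,R)$, and a pair consisting of a morphism $\alpha$ of $B^+$ and a morphism of $B^-$ (i.e. a coslice morphism $\gamma:(d_2,R_2)\to(d_1,R_1)$) to $(\alpha,\gamma)$. Dualization: for a presheaf $\varphi$ on $B^+$, $\varphi^\perp$ is the presheaf on $B^-$ with $\varphi^\perp(y)=\mathrm{Nat}(\varphi,\mathrm{Der}(\langle-,y\rangle_B))$ (natural transformations of presheaves on $B^+$), with the evident functoriality in $y$; for a presheaf $\psi$ on $B^-$, ${}^\perp\psi$ is the presheaf on $B^+$ with ${}^\perp\psi(x)=\mathrm{Nat}(\psi,\mathrm{Der}(\langle x,-\rangle_B))$. -}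

module Defs where

open import Level using (Level; _⊔_) renaming (suc to lsuc)
open import Relation.Binary using (Rel; IsEquivalence; Setoid)
open import Function.Bundles using (Func; _⟨$⟩_)
open import Data.Product using (_×_; _,_; proj₁; proj₂)
open import Relation.Binary.PropositionalEquality using (_≡_; refl)
import Relation.Binary.Reasoning.Setoid as SetoidR

private
  variable
    o ℓ e o' ℓ' e' o₁ ℓ₁ e₁ o₂ ℓ₂ e₂ c r c₁ r₁ c₂ r₂ : Level

record Category (o ℓ e : Level) : Set (lsuc (o ⊔ ℓ ⊔ e)) where
  infix 4 _≈_
  infixl 7 _⨾_
  field
    Obj : Set o
    _⇒_ : Obj → Obj → Set ℓ
    _≈_ : ∀ {A B} → Rel (A ⇒ B) e
    id : ∀ {A} → A ⇒ A
    _⨾_ : ∀ {A B C} → A ⇒ B → B ⇒ C → A ⇒ C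
    assoc : ∀ {W X Y Z} {f : W ⇒ X} {g : X ⇒ Y} {h : Y ⇒ Z} →
            (f ⨾ g) ⨾ h ≈ f ⨾ (g ⨾ h)
    identityˡ : ∀ {A B} {f : A ⇒ B} → id ⨾ f ≈ f
    identityʳ : ∀ {A B} {f : A ⇒ B} → f ⨾ id ≈ f
    equiv : ∀ {A B} → IsEquivalence (_≈_ {A} {B})
    ⨾-resp-≈ : ∀ {A B C} {f h : A ⇒ B} {g i : B ⇒ C} →
               f ≈ h → g ≈ i → f ⨾ g ≈ h ⨾ i

  hom-setoid : Obj → Obj → Setoid ℓ e
  hom-setoid A B = record { Carrier = A ⇒ B ; _≈_ = _≈_ ; isEquivalence = equiv }

  module Eq {A B : Obj} = IsEquivalence (equiv {A} {B})
  module HomR {A B : Obj} = SetoidR (hom-setoid A B)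

  assoc˘ : ∀ {W X Y Z} {f : W ⇒ X} {g : X ⇒ Y} {h : Y ⇒ Z} →
           f ⨾ (g ⨾ h) ≈ (f ⨾ g) ⨾ h
  assoc˘ = Eq.sym assoc

op : Category o ℓ e → Category o ℓ e
op C = record
  { Obj = Obj ; _⇒_ = λ A B → B ⇒ A ; _≈_ = _≈_ ; id = id
  ; _⨾_ = λ f g → g ⨾ f
  ; assoc = Eq.sym assoc ; identityˡ = identityʳ ; identityʳ = identityˡ
  ; equiv = equiv ; ⨾-resp-≈ = λ p q → ⨾-resp-≈ q p }
  where open Category C

Product : Category o₁ ℓ₁ e₁ → Category o₂ ℓ₂ e₂ →
          Category (o₁ ⊔ o₂) (ℓ₁ ⊔ ℓ₂) (e₁ ⊔ e₂)
Product C D = record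
  { Obj = C.Obj × D.Obj
  ; _⇒_ = λ X Y → (proj₁ X C.⇒ proj₁ Y) × (proj₂ X D.⇒ proj₂ Y)
  ; _≈_ = λ f g → (proj₁ f C.≈ proj₁ g) × (proj₂ f D.≈ proj₂ g)
  ; id = C.id , D.id
  ; _⨾_ = λ f g → (proj₁ f C.⨾ proj₁ g) , (proj₂ f D.⨾ proj₂ g)
  ; assoc = C.assoc , D.assoc
  ; identityˡ = C.identityˡ , D.identityˡ
  ; identityʳ = C.identityʳ , D.identityʳ
  ; equiv = record
      { refl = C.Eq.refl , D.Eq.refl
      ; sym = λ p → C.Eq.sym (proj₁ p) , D.Eq.sym (proj₂ p)
      ; trans = λ p q → C.Eq.trans (proj₁ p) (proj₁ q) , D.Eq.trans (proj₂ p) (proj₂ q) }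
  ; ⨾-resp-≈ = λ p q → C.⨾-resp-≈ (proj₁ p) (proj₁ q) , D.⨾-resp-≈ (proj₂ p) (proj₂ q)
  }
  where module C = Category C
        module D = Category D

record Functor (C : Category o ℓ e) (D : Category o' ℓ' e') :
               Set (o ⊔ ℓ ⊔ e ⊔ o' ⊔ ℓ' ⊔ e') where
  private
    module C = Category C
    module D = Category D
  field
    F₀ : C.Obj → D.Obj
    F₁ : ∀ {A B} → A C.⇒ B → F₀ A D.⇒ F₀ B
    identity : ∀ {A} → F₁ (C.id {A}) D.≈ D.id
    homomorphism : ∀ {X Y Z} {f : X C.⇒ Y} {g : Y C.⇒ Z} →
                   F₁ (f C.⨾ g) D.≈ F₁ f D.⨾ F₁ g
    F-resp-≈ : ∀ {A B} {f g : A C.⇒ B} → f C.≈ g → F₁ f D.≈ F₁ g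

fixʳ : {C : Category o₁ ℓ₁ e₁} {C' : Category o₂ ℓ₂ e₂} {D : Category o ℓ e} →
       Functor (Product C C') D → Category.Obj C' → Functor C D
fixʳ {C = C} {C'} {D} F y = record
  { F₀ = λ x → F₀ (x , y)
  ; F₁ = λ f → F₁ (f , C'.id)
  ; identity = identity
  ; homomorphism = D.Eq.trans (F-resp-≈ (C.Eq.refl , C'.Eq.sym C'.identityˡ)) homomorphism
  ; F-resp-≈ = λ p → F-resp-≈ (p , C'.Eq.refl) }
  where open Functor F
        module C = Category C
        module C' = Category C'
        module D = Category D

fixˡ : {C : Category o₁ ℓ₁ e₁} {C' : Category o₂ ℓ₂ e₂} {D : Category o ℓ e} →
       Functor (Product C C') D → Category.Obj C → Functor C' D
fixˡ {C = C} {C'} {D} F x = record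
  { F₀ = λ y → F₀ (x , y)
  ; F₁ = λ f → F₁ (C.id , f)
  ; identity = identity
  ; homomorphism = D.Eq.trans (F-resp-≈ (C.Eq.sym C.identityˡ , C'.Eq.refl)) homomorphism
  ; F-resp-≈ = λ p → F-resp-≈ (C.Eq.refl , p) }
  where open Functor F
        module C = Category C
        module C' = Category C'
        module D = Category D

record Presheaf (C : Category o ℓ e) (c r : Level) :
                Set (o ⊔ ℓ ⊔ e ⊔ lsuc (c ⊔ r)) where
  open Category C
  field
    F₀ : Obj → Setoid c r
  open module F₀S X = Setoid (F₀ X) using () renaming (Carrier to ∣_∣; _≈_ to [_]_≈_) public
  field
    F₁ : ∀ {X Y} → X ⇒ Y → Func (F₀ Y) (F₀ X)
    identity : ∀ {X} (a : ∣ X ∣) → [ X ] F₁ id ⟨$⟩ a ≈ a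
    homomorphism : ∀ {X Y Z} {f : X ⇒ Y} {g : Y ⇒ Z} (a : ∣ Z ∣) →
                   [ X ] F₁ (f ⨾ g) ⟨$⟩ a ≈ (F₁ f ⟨$⟩ (F₁ g ⟨$⟩ a))
    F-resp-≈ : ∀ {X Y} {f g : X ⇒ Y} → f ≈ g → (a : ∣ Y ∣) →
               [ X ] F₁ f ⟨$⟩ a ≈ (F₁ g ⟨$⟩ a)

reindex : {C : Category o ℓ e} {D : Category o' ℓ' e'} →
          Functor C D → Presheaf D c r → Presheaf C c r
reindex F P = record
  { F₀ = λ X → P.F₀ (F.F₀ X)
  ; F₁ = λ f → P.F₁ (F.F₁ f)
  ; identity = λ a → Setoid.trans (P.F₀ _) (P.F-resp-≈ F.identity a) (P.identity a)
  ; homomorphism = λ a → Setoid.trans (P.F₀ _) (P.F-resp-≈ F.homomorphism a) (P.homomorphism a)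
  ; F-resp-≈ = λ p a → P.F-resp-≈ (F.F-resp-≈ p) a }
  where module F = Functor F
        module P = Presheaf P

record NatTrans {C : Category o ℓ e} (F : Presheaf C c₁ r₁) (G : Presheaf C c₂ r₂) :
                Set (o ⊔ ℓ ⊔ c₁ ⊔ r₁ ⊔ c₂ ⊔ r₂) where
  private
    module F = Presheaf F
    module G = Presheaf G
  open Category C
  field
    η : ∀ X → Func (F.F₀ X) (G.F₀ X)
    commute : ∀ {X Y} (f : X ⇒ Y) (a : F.∣ Y ∣) →
              G.[ X ] η X ⟨$⟩ (F.F₁ f ⟨$⟩ a) ≈ (G.F₁ f ⟨$⟩ (η Y ⟨$⟩ a))

Nat : {C : Category o ℓ e} (F : Presheaf C c₁ r₁) (G : Presheaf C c₂ r₂) →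
      Setoid (o ⊔ ℓ ⊔ c₁ ⊔ r₁ ⊔ c₂ ⊔ r₂) (o ⊔ c₁ ⊔ r₂)
Nat F G = record
  { Carrier = NatTrans F G
  ; _≈_ = λ θ θ' → ∀ X (a : F.∣ X ∣) →
          G.[ X ] NatTrans.η θ X ⟨$⟩ a ≈ (NatTrans.η θ' X ⟨$⟩ a)
  ; isEquivalence = record
      { refl = λ X a → Setoid.refl (G.F₀ X)
      ; sym = λ p X a → Setoid.sym (G.F₀ X) (p X a)
      ; trans = λ p q X a → Setoid.trans (G.F₀ X) (p X a) (q X a) } }
  where module F = Presheaf F
        module G = Presheaf G

record NatIso {C : Category o ℓ e} (F : Presheaf C c₁ r₁) (G : Presheaf C c₂ r₂) :
              Set (o ⊔ ℓ ⊔ c₁ ⊔ r₁ ⊔ c₂ ⊔ r₂) where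
  private
    module F = Presheaf F
    module G = Presheaf G
  field
    to : NatTrans F G
    from : NatTrans G F
    isoˡ : ∀ X (a : F.∣ X ∣) →
           F.[ X ] NatTrans.η from X ⟨$⟩ (NatTrans.η to X ⟨$⟩ a) ≈ a
    isoʳ : ∀ X (b : G.∣ X ∣) →
           G.[ X ] NatTrans.η to X ⟨$⟩ (NatTrans.η from X ⟨$⟩ b) ≈ b

postcomp : {C : Category o ℓ e} {F : Presheaf C c r} {G : Presheaf C c₁ r₁}
           {H : Presheaf C c₂ r₂} → NatTrans G H → Func (Nat F G) (Nat F H)
postcomp {F = F} {G} {H} σ = record
  { to = λ θ → record
      { η = λ X → record
          { to = λ a → σ.η X ⟨$⟩ (NatTrans.η θ X ⟨$⟩ a)
          ; cong = λ p → Func.cong (σ.η X) (Func.cong (NatTrans.η θ X) p) }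
      ; commute = λ f a → Setoid.trans (H.F₀ _)
          (Func.cong (σ.η _) (NatTrans.commute θ f a)) (σ.commute f _) }
  ; cong = λ p X a → Func.cong (σ.η X) (p X a) }
  where module σ = NatTrans σ
        module H = Presheaf H

precomp : {C : Category o ℓ e} {F : Presheaf C c r} {G : Presheaf C c₁ r₁}
          {H : Presheaf C c₂ r₂} → NatTrans F G → Func (Nat G H) (Nat F H)
precomp {F = F} {G} {H} σ = record
  { to = λ θ → record
      { η = λ X → record
          { to = λ a → NatTrans.η θ X ⟨$⟩ (σ.η X ⟨$⟩ a)
          ; cong = λ p → Func.cong (NatTrans.η θ X) (Func.cong (σ.η X) p) }
      ; commute = λ f a → Setoid.trans (H.F₀ _)
          (Func.cong (NatTrans.η θ _) (σ.commute f a)) (NatTrans.commute θ f _) }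
  ; cong = λ p X a → p X _ }
  where module σ = NatTrans σ
        module H = Presheaf H

module _ {C : Category o₁ ℓ₁ e₁} {C' : Category o₂ ℓ₂ e₂} {D : Category o ℓ e}
         (F : Functor (Product C C') D) (P : Presheaf D c r) where
  private
    module C = Category C
    module C' = Category C'
    module D = Category D
    module F = Functor F
    module P = Presheaf P
    CC' = Product C C'
    module CC' = Category CC'

    swap : ∀ {X Y Z W} {u : X CC'.⇒ Y} {v : Y CC'.⇒ Z} {u' : X CC'.⇒ W} {v' : W CC'.⇒ Z} →
           u CC'.⨾ v CC'.≈ u' CC'.⨾ v' → (a : P.∣ F.F₀ Z ∣) →
           P.[ F.F₀ X ] P.F₁ (F.F₁ u) ⟨$⟩ (P.F₁ (F.F₁ v) ⟨$⟩ a)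
                      ≈ (P.F₁ (F.F₁ u') ⟨$⟩ (P.F₁ (F.F₁ v') ⟨$⟩ a))
    swap {u = u} {v} {u'} {v'} eq a = begin
        P.F₁ (F.F₁ u) ⟨$⟩ (P.F₁ (F.F₁ v) ⟨$⟩ a)  ≈⟨ Setoid.sym (P.F₀ _) (P.homomorphism a) ⟩
        P.F₁ (F.F₁ u D.⨾ F.F₁ v) ⟨$⟩ a            ≈⟨ P.F-resp-≈ (D.Eq.sym F.homomorphism) a ⟩
        P.F₁ (F.F₁ (u CC'.⨾ v)) ⟨$⟩ a             ≈⟨ P.F-resp-≈ (F.F-resp-≈ eq) a ⟩
        P.F₁ (F.F₁ (u' CC'.⨾ v')) ⟨$⟩ a           ≈⟨ P.F-resp-≈ F.homomorphism a ⟩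
        P.F₁ (F.F₁ u' D.⨾ F.F₁ v') ⟨$⟩ a          ≈⟨ P.homomorphism a ⟩
        P.F₁ (F.F₁ u') ⟨$⟩ (P.F₁ (F.F₁ v') ⟨$⟩ a) ∎
      where open SetoidR (P.F₀ _)

  fixNatʳ : ∀ {x y} → x C'.⇒ y →
            NatTrans (reindex (fixʳ F y) P) (reindex (fixʳ F x) P)
  fixNatʳ g = record
    { η = λ X → P.F₁ (F.F₁ (C.id , g))
    ; commute = λ f a → swap ( C.Eq.trans C.identityˡ (C.Eq.sym C.identityʳ)
                             , C'.Eq.trans C'.identityʳ (C'.Eq.sym C'.identityˡ) ) a }

  fixNatˡ : ∀ {x y} → x C.⇒ y →
            NatTrans (reindex (fixˡ F y) P) (reindex (fixˡ F x) P)
  fixNatˡ g = record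
    { η = λ X → P.F₁ (F.F₁ (g , C'.id))
    ; commute = λ f a → swap ( C.Eq.trans C.identityʳ (C.Eq.sym C.identityˡ)
                             , C'.Eq.trans C'.identityˡ (C'.Eq.sym C'.identityʳ) ) a }

  perpʳ : Presheaf C c₁ r₁ →
          Presheaf C' (o₁ ⊔ ℓ₁ ⊔ c₁ ⊔ r₁ ⊔ c ⊔ r) (o₁ ⊔ c₁ ⊔ r)
  perpʳ φ = record
    { F₀ = λ y → Nat φ (reindex (fixʳ F y) P)
    ; F₁ = λ g → postcomp (fixNatʳ g)
    ; identity = λ θ X a → Setoid.trans (P.F₀ _) (P.F-resp-≈ F.identity _) (P.identity _)
    ; homomorphism = λ θ X a → Setoid.trans (P.F₀ _)
        (P.F-resp-≈ (D.Eq.trans (F.F-resp-≈ (C.Eq.sym C.identityˡ , C'.Eq.refl)) F.homomorphism) _)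
        (P.homomorphism _)
    ; F-resp-≈ = λ p θ X a → P.F-resp-≈ (F.F-resp-≈ (C.Eq.refl , p)) _ }

  perpˡ : Presheaf C' c₁ r₁ →
          Presheaf C (o₂ ⊔ ℓ₂ ⊔ c₁ ⊔ r₁ ⊔ c ⊔ r) (o₂ ⊔ c₁ ⊔ r)
  perpˡ ψ = record
    { F₀ = λ x → Nat ψ (reindex (fixˡ F x) P)
    ; F₁ = λ g → postcomp (fixNatˡ g)
    ; identity = λ θ X a → Setoid.trans (P.F₀ _) (P.F-resp-≈ F.identity _) (P.identity _)
    ; homomorphism = λ θ X a → Setoid.trans (P.F₀ _)
        (P.F-resp-≈ (D.Eq.trans (F.F-resp-≈ (C.Eq.refl , C'.Eq.sym C'.identityˡ)) F.homomorphism) _)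
        (P.homomorphism _)
    ; F-resp-≈ = λ p θ X a → P.F-resp-≈ (F.F-resp-≈ (p , C'.Eq.refl)) _ }

module RefinementSystem {o ℓ e o' ℓ' e' : Level}
         {𝒟 : Category o ℓ e} {𝒯 : Category o' ℓ' e'} (t : Functor 𝒟 𝒯) where
  private
    module D = Category 𝒟
    module T = Category 𝒯
  open Functor t using () renaming (F₀ to t₀; F₁ to t₁)
  private
    module t = Functor t

  _⊏_ : D.Obj → T.Obj → Set o'
  P ⊏ A = t₀ P ≡ A

  record Derivation (P Q : D.Obj) (c : t₀ P T.⇒ t₀ Q) : Set (ℓ ⊔ e') where
    constructor deriv
    field
      mor  : P D.⇒ Q
      over : t₁ mor T.≈ c
  open Derivation public

  DerSetoid : (P Q : D.Obj) (c : t₀ P T.⇒ t₀ Q) → Setoid (ℓ ⊔ e') e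
  DerSetoid P Q c = record
    { Carrier = Derivation P Q c
    ; _≈_ = λ α β → mor α D.≈ mor β
    ; isEquivalence = record { refl = D.Eq.refl ; sym = D.Eq.sym ; trans = D.Eq.trans } }

  did : ∀ {P} → Derivation P P T.id
  did = deriv D.id t.identity

  dcomp : ∀ {P Q R} {c : t₀ P T.⇒ t₀ Q} {c' : t₀ Q T.⇒ t₀ R} →
          Derivation P Q c → Derivation Q R c' → Derivation P R (c T.⨾ c')
  dcomp α β = deriv (mor α D.⨾ mor β)
                    (T.Eq.trans t.homomorphism (T.⨾-resp-≈ (over α) (over β)))

  dcast : ∀ {P Q} {c c' : t₀ P T.⇒ t₀ Q} → c T.≈ c' → Derivation P Q c → Derivation P Q c'
  dcast p α = deriv (mor α) (T.Eq.trans (over α) p)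

  record SliceObj (B : T.Obj) : Set (o ⊔ ℓ') where
    constructor sl
    field
      dom : D.Obj
      arr : t₀ dom T.⇒ B
  open SliceObj public

  record SliceMor {B : T.Obj} (x y : SliceObj B) : Set (ℓ ⊔ ℓ' ⊔ e') where
    constructor slm
    field
      lbl : t₀ (dom x) T.⇒ t₀ (dom y)
      der : Derivation (dom x) (dom y) lbl
      tri : arr x T.≈ lbl T.⨾ arr y
  open SliceMor public

  _⁺ : T.Obj → Category (o ⊔ ℓ') (ℓ ⊔ ℓ' ⊔ e') e
  B ⁺ = record
    { Obj = SliceObj B
    ; _⇒_ = SliceMor
    ; _≈_ = λ f g → mor (der f) D.≈ mor (der g)
    ; id = slm T.id did (T.Eq.sym T.identityˡ)
    ; _⨾_ = λ f g → slm (lbl f T.⨾ lbl g) (dcomp (der f) (der g))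
        (T.Eq.trans (tri f) (T.Eq.trans (T.⨾-resp-≈ T.Eq.refl (tri g)) T.assoc˘))
    ; assoc = D.assoc ; identityˡ = D.identityˡ ; identityʳ = D.identityʳ
    ; equiv = record { refl = D.Eq.refl ; sym = D.Eq.sym ; trans = D.Eq.trans }
    ; ⨾-resp-≈ = D.⨾-resp-≈ }

  record CosliceObj (B : T.Obj) : Set (o ⊔ ℓ') where
    constructor cs
    field
      cod  : D.Obj
      carr : B T.⇒ t₀ cod
  open CosliceObj public

  record CosliceMor {B : T.Obj} (x y : CosliceObj B) : Set (ℓ ⊔ ℓ' ⊔ e') where
    constructor csm
    field
      clbl : t₀ (cod x) T.⇒ t₀ (cod y)
      cder : Derivation (cod x) (cod y) clbl
      ctri : carr x T.⨾ clbl T.≈ carr y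
  open CosliceMor public

  Coslice : T.Obj → Category (o ⊔ ℓ') (ℓ ⊔ ℓ' ⊔ e') e
  Coslice B = record
    { Obj = CosliceObj B
    ; _⇒_ = CosliceMor
    ; _≈_ = λ f g → mor (cder f) D.≈ mor (cder g)
    ; id = csm T.id did T.identityʳ
    ; _⨾_ = λ f g → csm (clbl f T.⨾ clbl g) (dcomp (cder f) (cder g))
        (T.Eq.trans T.assoc˘ (T.Eq.trans (T.⨾-resp-≈ (ctri f) T.Eq.refl) (ctri g)))
    ; assoc = D.assoc ; identityˡ = D.identityˡ ; identityʳ = D.identityʳ
    ; equiv = record { refl = D.Eq.refl ; sym = D.Eq.sym ; trans = D.Eq.trans }
    ; ⨾-resp-≈ = D.⨾-resp-≈ }

  _⁻ : T.Obj → Category (o ⊔ ℓ') (ℓ ⊔ ℓ' ⊔ e') e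
  B ⁻ = op (Coslice B)

  record Judgment : Set (o ⊔ ℓ') where
    constructor jdg
    field
      src : D.Obj
      tgt : D.Obj
      lab : t₀ src T.⇒ t₀ tgt
  open Judgment public

  record JMor (x y : Judgment) : Set (ℓ ⊔ ℓ' ⊔ e') where
    constructor jm
    field
      lblₗ : t₀ (src x) T.⇒ t₀ (src y)
      derₗ : Derivation (src x) (src y) lblₗ
      lblᵣ : t₀ (tgt y) T.⇒ t₀ (tgt x)
      derᵣ : Derivation (tgt y) (tgt x) lblᵣ
      eqn  : lab x T.≈ (lblₗ T.⨾ lab y) T.⨾ lblᵣ
  open JMor public

  private
    jcomp-eqn : ∀ {x y z} (f : JMor x y) (g : JMor y z) →
                lab x T.≈ ((lblₗ f T.⨾ lblₗ g) T.⨾ lab z) T.⨾ (lblᵣ g T.⨾ lblᵣ f)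
    jcomp-eqn {x} {y} {z} f g = begin
      lab x                                                   ≈⟨ eqn f ⟩
      (lblₗ f T.⨾ lab y) T.⨾ lblᵣ f                            ≈⟨ T.⨾-resp-≈ (T.⨾-resp-≈ T.Eq.refl (eqn g)) T.Eq.refl ⟩
      (lblₗ f T.⨾ ((lblₗ g T.⨾ lab z) T.⨾ lblᵣ g)) T.⨾ lblᵣ f  ≈⟨ T.⨾-resp-≈ T.assoc˘ T.Eq.refl ⟩
      ((lblₗ f T.⨾ (lblₗ g T.⨾ lab z)) T.⨾ lblᵣ g) T.⨾ lblᵣ f  ≈⟨ T.assoc ⟩
      (lblₗ f T.⨾ (lblₗ g T.⨾ lab z)) T.⨾ (lblᵣ g T.⨾ lblᵣ f)  ≈⟨ T.⨾-resp-≈ T.assoc˘ T.Eq.refl ⟩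
      ((lblₗ f T.⨾ lblₗ g) T.⨾ lab z) T.⨾ (lblᵣ g T.⨾ lblᵣ f)  ∎
      where open T.HomR

  J : Category (o ⊔ ℓ') (ℓ ⊔ ℓ' ⊔ e') e
  J = record
    { Obj = Judgment
    ; _⇒_ = JMor
    ; _≈_ = λ f g → (mor (derₗ f) D.≈ mor (derₗ g)) × (mor (derᵣ f) D.≈ mor (derᵣ g))
    ; id = jm T.id did T.id did
        (T.Eq.sym (T.Eq.trans T.identityʳ T.identityˡ))
    ; _⨾_ = λ f g → jm (lblₗ f T.⨾ lblₗ g) (dcomp (derₗ f) (derₗ g))
                       (lblᵣ g T.⨾ lblᵣ f) (dcomp (derᵣ g) (derᵣ f)) (jcomp-eqn f g)
    ; assoc = D.assoc , D.Eq.sym D.assoc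
    ; identityˡ = D.identityˡ , D.identityʳ
    ; identityʳ = D.identityʳ , D.identityˡ
    ; equiv = record
        { refl = D.Eq.refl , D.Eq.refl
        ; sym = λ p → D.Eq.sym (proj₁ p) , D.Eq.sym (proj₂ p)
        ; trans = λ p q → D.Eq.trans (proj₁ p) (proj₁ q) , D.Eq.trans (proj₂ p) (proj₂ q) }
    ; ⨾-resp-≈ = λ p q → D.⨾-resp-≈ (proj₁ p) (proj₁ q) , D.⨾-resp-≈ (proj₂ q) (proj₂ p) }

  Der : Presheaf J (ℓ ⊔ e') e
  Der = record
    { F₀ = λ x → DerSetoid (src x) (tgt x) (lab x)
    ; F₁ = λ f → record
        { to = λ α → deriv ((mor (derₗ f) D.⨾ mor α) D.⨾ mor (derᵣ f))
            (T.Eq.trans (over (dcomp (dcomp (derₗ f) α) (derᵣ f))) (T.Eq.sym (eqn f)))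
        ; cong = λ p → D.⨾-resp-≈ (D.⨾-resp-≈ D.Eq.refl p) D.Eq.refl }
    ; identity = λ α → D.Eq.trans D.identityʳ D.identityˡ
    ; homomorphism = λ {_} {_} {_} {f} {g} α → begin
        ((mor (derₗ f) D.⨾ mor (derₗ g)) D.⨾ mor α) D.⨾ (mor (derᵣ g) D.⨾ mor (derᵣ f))
          ≈⟨ D.⨾-resp-≈ D.assoc D.Eq.refl ⟩
        (mor (derₗ f) D.⨾ (mor (derₗ g) D.⨾ mor α)) D.⨾ (mor (derᵣ g) D.⨾ mor (derᵣ f))
          ≈⟨ D.assoc˘ ⟩
        ((mor (derₗ f) D.⨾ (mor (derₗ g) D.⨾ mor α)) D.⨾ mor (derᵣ g)) D.⨾ mor (derᵣ f)
          ≈⟨ D.⨾-resp-≈ D.assoc D.Eq.refl ⟩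
        (mor (derₗ f) D.⨾ ((mor (derₗ g) D.⨾ mor α) D.⨾ mor (derᵣ g))) D.⨾ mor (derᵣ f) ∎
    ; F-resp-≈ = λ p α → D.⨾-resp-≈ (D.⨾-resp-≈ (proj₁ p) D.Eq.refl) (proj₂ p) }
    where open D.HomR

  bracket : (B : T.Obj) → Functor (Product (B ⁺) (B ⁻)) J
  bracket B = record
    { F₀ = λ xy → jdg (dom (proj₁ xy)) (cod (proj₂ xy)) (arr (proj₁ xy) T.⨾ carr (proj₂ xy))
    ; F₁ = λ fg → jm (lbl (proj₁ fg)) (der (proj₁ fg)) (clbl (proj₂ fg)) (cder (proj₂ fg))
                     (br-eqn (proj₁ fg) (proj₂ fg))
    ; identity = D.Eq.refl , D.Eq.refl
    ; homomorphism = D.Eq.refl , D.Eq.refl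
    ; F-resp-≈ = λ p → p }
    where
      br-eqn : ∀ {x₁ x₂ : SliceObj B} {y₁ y₂ : CosliceObj B}
               (α : SliceMor x₁ x₂) (γ : CosliceMor y₂ y₁) →
               arr x₁ T.⨾ carr y₁ T.≈ (lbl α T.⨾ (arr x₂ T.⨾ carr y₂)) T.⨾ clbl γ
      br-eqn {x₁} {x₂} {y₁} {y₂} α γ = begin
        arr x₁ T.⨾ carr y₁                             ≈⟨ T.⨾-resp-≈ (tri α) (T.Eq.sym (ctri γ)) ⟩
        (lbl α T.⨾ arr x₂) T.⨾ (carr y₂ T.⨾ clbl γ)     ≈⟨ T.assoc˘ ⟩
        ((lbl α T.⨾ arr x₂) T.⨾ carr y₂) T.⨾ clbl γ     ≈⟨ T.⨾-resp-≈ T.assoc T.Eq.refl ⟩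
        (lbl α T.⨾ (arr x₂ T.⨾ carr y₂)) T.⨾ clbl γ     ∎
        where open T.HomR

  _^⊥ : ∀ {B c r} → Presheaf (B ⁺) c r →
        Presheaf (B ⁻) (o ⊔ ℓ' ⊔ ℓ ⊔ e' ⊔ c ⊔ r ⊔ e) (o ⊔ ℓ' ⊔ c ⊔ e)
  _^⊥ {B} φ = perpʳ (bracket B) Der φ

  ⊥_ : ∀ {B c r} → Presheaf (B ⁻) c r →
       Presheaf (B ⁺) (o ⊔ ℓ' ⊔ ℓ ⊔ e' ⊔ c ⊔ r ⊔ e) (o ⊔ ℓ' ⊔ c ⊔ e)
  ⊥_ {B} ψ = perpˡ (bracket B) Der ψ

  private
    Q⁺′ : (Q : D.Obj) → Presheaf (t₀ Q ⁺) (ℓ ⊔ e') e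
    Q⁺′ Q = record
      { F₀ = λ x → DerSetoid (dom x) Q (arr x)
      ; F₁ = λ f → record
          { to = λ β → deriv (mor (der f) D.⨾ mor β)
              (T.Eq.trans (over (dcomp (der f) β)) (T.Eq.sym (tri f)))
          ; cong = λ p → D.⨾-resp-≈ D.Eq.refl p }
      ; identity = λ β → D.identityˡ
      ; homomorphism = λ β → D.assoc
      ; F-resp-≈ = λ p β → D.⨾-resp-≈ p D.Eq.refl }

    Q⁻′ : (Q : D.Obj) → Presheaf (t₀ Q ⁻) (ℓ ⊔ e') e
    Q⁻′ Q = record
      { F₀ = λ y → DerSetoid Q (cod y) (carr y)
      ; F₁ = λ g → record
          { to = λ β → deriv (mor β D.⨾ mor (cder g))
              (T.Eq.trans (over (dcomp β (cder g))) (ctri g))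
          ; cong = λ p → D.⨾-resp-≈ p D.Eq.refl }
      ; identity = λ β → D.identityʳ
      ; homomorphism = λ β → D.Eq.sym D.assoc
      ; F-resp-≈ = λ p β → D.⨾-resp-≈ D.Eq.refl p }

  Q⁺ : (B : T.Obj) (Q : D.Obj) → Q ⊏ B → Presheaf (B ⁺) (ℓ ⊔ e') e
  Q⁺ _ Q refl = Q⁺′ Q

  Q⁻ : (B : T.Obj) (Q : D.Obj) → Q ⊏ B → Presheaf (B ⁻) (ℓ ⊔ e') e
  Q⁻ _ Q refl = Q⁻′ Q

-- Q⁺ is represented by (Q, id) in B⁺ and Q⁻ by (id, Q) in the coslice of B, so both
-- isomorphisms are instances of the Yoneda lemma: a natural transformation out of Q⁺
-- (resp. Q⁻) is determined by its value on the identity derivation of Q, and that value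
-- is a derivation out of (resp. into) Q, i.e. an element of Q⁻ (resp. Q⁺).
module Submission where

open import Defs
open import Level using (Level; _⊔_)
open import Data.Product using (_×_; _,_)
open import Relation.Binary.PropositionalEquality using (refl)
open import Function.Bundles using (Func; _⟨$⟩_)

module Duality {o ℓ e o' ℓ' e' : Level}
    {𝒟 : Category o ℓ e} {𝒯 : Category o' ℓ' e'}
    (t : Functor 𝒟 𝒯) (Q : Category.Obj 𝒟) where
  open RefinementSystem t
  open Functor t using () renaming (F₀ to t₀)
  open NatTrans
  private
    module D = Category 𝒟
    module T = Category 𝒯

    B : T.Obj
    B = t₀ Q

  idSlice : SliceObj B
  idSlice = sl Q T.id

  idCoslice : CosliceObj B
  idCoslice = cs Q T.id

  derivation⇒sliceMor : ∀ {x} → Derivation (dom x) Q (arr x) → SliceMor x idSlice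
  derivation⇒sliceMor {x} α = slm (arr x) α (T.Eq.sym T.identityʳ)

  derivation⇒cosliceMor : ∀ {y} → Derivation Q (cod y) (carr y) → CosliceMor idCoslice y
  derivation⇒cosliceMor {y} β = csm (carr y) β T.identityˡ

  Der⟨-,_⟩ : CosliceObj B → Presheaf (B ⁺) (ℓ ⊔ e') e
  Der⟨-, y ⟩ = reindex (fixʳ (bracket B) y) Der

  Der⟨_,-⟩ : SliceObj B → Presheaf (B ⁻) (ℓ ⊔ e') e
  Der⟨ x ,-⟩ = reindex (fixˡ (bracket B) x) Der

  postcomposeWith : ∀ {y} → Derivation Q (cod y) (carr y) → NatTrans (Q⁺ B Q refl) Der⟨-, y ⟩
  postcomposeWith β = record
    { η = λ x → record { to = λ α → dcomp α β ; cong = λ p → D.⨾-resp-≈ p D.Eq.refl }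
    ; commute = λ f α → D.Eq.trans D.assoc (D.Eq.sym D.identityʳ) }

  precomposeWith : ∀ {x} → Derivation (dom x) Q (arr x) → NatTrans (Q⁻ B Q refl) Der⟨ x ,-⟩
  precomposeWith α = record
    { η = λ y → record { to = λ β → dcomp α β ; cong = λ p → D.⨾-resp-≈ D.Eq.refl p }
    ; commute = λ g β → D.Eq.trans D.assoc˘ (D.Eq.sym (D.⨾-resp-≈ D.identityˡ D.Eq.refl)) }

  Q⁺-yoneda : ∀ {x y} (θ : NatTrans (Q⁺ B Q refl) Der⟨-, y ⟩) (α : Derivation (dom x) Q (arr x)) →
              mor α D.⨾ mor (η θ idSlice ⟨$⟩ did) D.≈ mor (η θ x ⟨$⟩ α)
  Q⁺-yoneda {x} θ α = begin
    mor α D.⨾ mor (η θ idSlice ⟨$⟩ did)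
      ≈⟨ D.Eq.sym D.identityʳ ⟩
    (mor α D.⨾ mor (η θ idSlice ⟨$⟩ did)) D.⨾ D.id
      ≈⟨ D.Eq.sym (commute θ (derivation⇒sliceMor α) did) ⟩
    mor (η θ x ⟨$⟩ (Presheaf.F₁ (Q⁺ B Q refl) (derivation⇒sliceMor α) ⟨$⟩ did))
      ≈⟨ Func.cong (η θ x) D.identityʳ ⟩
    mor (η θ x ⟨$⟩ α) ∎
    where open D.HomR

  Q⁻-yoneda : ∀ {x y} (θ : NatTrans (Q⁻ B Q refl) Der⟨ x ,-⟩) (β : Derivation Q (cod y) (carr y)) →
              mor (η θ idCoslice ⟨$⟩ did) D.⨾ mor β D.≈ mor (η θ y ⟨$⟩ β)
  Q⁻-yoneda {y = y} θ β = begin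
    mor (η θ idCoslice ⟨$⟩ did) D.⨾ mor β
      ≈⟨ D.⨾-resp-≈ (D.Eq.sym D.identityˡ) D.Eq.refl ⟩
    (D.id D.⨾ mor (η θ idCoslice ⟨$⟩ did)) D.⨾ mor β
      ≈⟨ D.Eq.sym (commute θ (derivation⇒cosliceMor β) did) ⟩
    mor (η θ y ⟨$⟩ (Presheaf.F₁ (Q⁻ B Q refl) (derivation⇒cosliceMor β) ⟨$⟩ did))
      ≈⟨ Func.cong (η θ y) D.identityˡ ⟩
    mor (η θ y ⟨$⟩ β) ∎
    where open D.HomR

  postcomposition : NatTrans (Q⁻ B Q refl) ((Q⁺ B Q refl) ^⊥)
  postcomposition = record
    { η = λ y → record { to = postcomposeWith ; cong = λ p x α → D.⨾-resp-≈ D.Eq.refl p }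
    ; commute = λ g β x α → D.Eq.trans D.assoc˘ (D.Eq.sym (D.⨾-resp-≈ D.identityˡ D.Eq.refl)) }

  precomposition : NatTrans (Q⁺ B Q refl) (⊥ (Q⁻ B Q refl))
  precomposition = record
    { η = λ x → record { to = precomposeWith ; cong = λ p y β → D.⨾-resp-≈ p D.Eq.refl }
    ; commute = λ f α y β → D.Eq.trans D.assoc (D.Eq.sym D.identityʳ) }

  evaluateAtIdSlice : NatTrans ((Q⁺ B Q refl) ^⊥) (Q⁻ B Q refl)
  evaluateAtIdSlice = record
    { η = λ y → record
        { to = λ θ → dcast T.identityˡ (η θ idSlice ⟨$⟩ did)
        ; cong = λ p → p idSlice did }
    ; commute = λ g θ → D.⨾-resp-≈ D.identityˡ D.Eq.refl }

  evaluateAtIdCoslice : NatTrans (⊥ (Q⁻ B Q refl)) (Q⁺ B Q refl)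
  evaluateAtIdCoslice = record
    { η = λ x → record
        { to = λ θ → dcast T.identityʳ (η θ idCoslice ⟨$⟩ did)
        ; cong = λ p → p idCoslice did }
    ; commute = λ f θ → D.identityʳ }

  Q⁻≅Q⁺^⊥ : NatIso (Q⁻ B Q refl) ((Q⁺ B Q refl) ^⊥)
  Q⁻≅Q⁺^⊥ = record
    { to = postcomposition
    ; from = evaluateAtIdSlice
    ; isoˡ = λ y β → D.identityˡ
    ; isoʳ = λ y θ x → Q⁺-yoneda θ }

  Q⁺≅⊥Q⁻ : NatIso (Q⁺ B Q refl) (⊥ (Q⁻ B Q refl))
  Q⁺≅⊥Q⁻ = record
    { to = precomposition
    ; from = evaluateAtIdCoslice
    ; isoˡ = λ x α → D.identityʳ
    ; isoʳ = λ x θ y → Q⁻-yoneda θ }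

theorem4p9 : ∀ {o ℓ e o' ℓ' e' : Level}
    {𝒟 : Category o ℓ e} {𝒯 : Category o' ℓ' e'}
    (t : Functor 𝒟 𝒯) (B : Category.Obj 𝒯) (Q : Category.Obj 𝒟) →
    let open RefinementSystem t in
    (q : Q ⊏ B) →
    NatIso (Q⁻ B Q q) ((Q⁺ B Q q) ^⊥)
    × NatIso (Q⁺ B Q q) (⊥ (Q⁻ B Q q))
theorem4p9 t .(Functor.F₀ t Q) Q refl = Duality.Q⁻≅Q⁺^⊥ t Q , Duality.Q⁺≅⊥Q⁻ t Q
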